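{- Let $\pi$ be a permutation and let $(\pi_1,\ldots,\pi_n)$ be the unique ordered tuple of permutations such that $\pi=\pi_1\oplus\cdots\oplus\pi_n$, each word $\overline{\pi_i}$ is a Lyndon word, and $\pi_1\ge_L\pi_2\ge_L\cdots\ge_L\pi_n$. If a permutation $\sigma$ is a constituent of the flag product $\pi_1\times\cdots\times\pi_n$ and $\sigma\neq\pi$, then either $\sigma$ has fewer indecomposable blocks than $\pi$, or $\sigma$ and $\pi$ have the same number of indecomposable blocks and $\overline{\sigma}$ is lexicographically smaller than $\overline{\pi}$.
   Context: A permutation of size $n$ is a bijection $\pi:[n]\to[n]$. The direct sum $\pi_1\oplus\pi_2$ of permutations of sizes $a,b$ is the permutation $\pi$ of size $a+b$ with $\pi(i)=\pi_1(i)$ for $i\in[a]$ and $\pi(a+i)=a+\pi_2(i)$ for $i\in[b]$. A permutation is indecomposable if it is not the direct sum of two permutations (of positive sizes). Every permutation $\pi$ is uniquely a direct sum $\tau_1\oplus\cdots\oplus\tau_m$ of indecomposable permutations, its indecomposable blocks; write $\overline{\pi}$ for the word $\tau_1\dots\tau_m$ over the alphabet $\Sigma$ of indecomposable permutations. $\Sigma$ is linearly ordered so that indecomposable permutations of smaller size precede those of larger size, and those of equal size are ordered lexicographically as words. Words over $\Sigma$ are compared lexicographically (a proper prefix is smaller). A word is Lyndon if every proper suffix is lexicographically strictly larger than the word. For permutations, $\pi\le_L\pi'$ (resp. $<_L$, $\ge_L$, $>_L$) means $\overline{\pi}$ is lexicographically at most (resp. smaller than, at least, larger than) $\overline{\pi'}$.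 (Every word over $\Sigma$ is uniquely a concatenation of lexicographically non-increasing Lyndon words, which gives the existence and uniqueness of the tuple.) For $1\le k_1<\dots<k_m\le n$, the pattern induced by $\{k_1,\dots,k_m\}$ in a permutation $\pi$ of size $n$ is the permutation $\sigma$ of size $m$ with $\sigma(i)<\sigma(i')$ iff $\pi(k_i)<\pi(k_{i'})$. The flag product $\pi_1\times\pi_2$ of permutations of sizes $k_1,k_2$ is the formal linear combination over all permutations $\sigma$ of size $k_1+k_2$ in which the coefficient of $\sigma$ is the number of $k_1$-element sets $S\subseteq[k_1+k_2]$ such that $S$ induces $\pi_1$ and $[k_1+k_2]\setminus S$ induces $\pi_2$ in $\sigma$, divided by $\binom{k_1+k_2}{k_1}$; this is extended bilinearly and iterated to products $\pi_1\times\cdots\times\pi_n$ (the product is associative). A constituent of a formal linear combination is a permutation having nonzero coefficient in it. -}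

module Defs where

open import Data.Nat using (ℕ; zero; suc; _+_; _<_; _≤_; z<s; NonZero; >-nonZero)
open import Data.Nat.Properties using (_<?_; +-identityʳ; <-≤-trans; m≤m+n)
open import Data.Nat.Combinatorics using (_C_; nCn≡1; nCk+nC[k+1]≡[n+1]C[k+1])
open import Data.Integer using () renaming (+_ to ℤ+_)
open import Data.Rational using (ℚ; _/_; 0ℚ; 1ℚ; _*_) renaming (_+_ to _+ℚ_)
open import Data.List using (List; []; _∷_; [_]; _++_; map; length; filter; concatMap; foldl; upTo)
open import Data.List.Properties using (≡-dec)
open import Data.List.Relation.Binary.Permutation.Propositional using (_↭_)
open import Data.List.Relation.Binary.Lex.Core using (Lex-<; Lex-≤)
open import Data.List.Relation.Unary.All using (All)
open import Data.Bool using (Bool; true; false; not; if_then_else_)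
open import Data.Product using (_×_; _,_)
open import Data.Sum using (_⊎_)
open import Relation.Nullary using (¬_; does)
open import Relation.Nullary.Decidable using (_×-dec_)
open import Relation.Binary.PropositionalEquality using (_≡_; _≢_; subst; sym)
import Data.Nat as ℕ

-- Permutations in one-line notation, with values 0,…,n-1.
-- A permutation of size n is a list w of length n that is a
-- rearrangement of [0,…,n-1]; it is the bijection i ↦ (w !! i).

IsPerm : List ℕ → Set
IsPerm w = w ↭ upTo (length w)

infixr 5 _⊕_
_⊕_ : List ℕ → List ℕ → List ℕ
u ⊕ v = u ++ map (length u +_) v

⊕-all : List (List ℕ) → List ℕ
⊕-all []       = []
⊕-all (p ∷ ps) = p ⊕ ⊕-all ps

Indecomposable : List ℕ → Set
Indecomposable τ =
  IsPerm τ × τ ≢ [] ×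
  (∀ u v → IsPerm u → IsPerm v → u ≢ [] → v ≢ [] → τ ≢ u ⊕ v)

-- bs is the word π̄ of indecomposable blocks of π (π = τ₁ ⊕ ⋯ ⊕ τₘ).
-- (This decomposition exists and is unique for every permutation.)
BlockWord : List ℕ → List (List ℕ) → Set
BlockWord π bs = All Indecomposable bs × π ≡ ⊕-all bs

_<Σ_ : List ℕ → List ℕ → Set
τ <Σ τ' = length τ < length τ'
        ⊎ (length τ ≡ length τ' × Lex-< _≡_ _<_ τ τ')

_<W_ : List (List ℕ) → List (List ℕ) → Set
_<W_ = Lex-< _≡_ _<Σ_

_≤W_ : List (List ℕ) → List (List ℕ) → Set
_≤W_ = Lex-≤ _≡_ _<Σ_

Lyndon : List (List ℕ) → Set
Lyndon w = w ≢ [] × (∀ p s → p ≢ [] → s ≢ [] → w ≡ p ++ s → w <W s)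

select : List Bool → List ℕ → List ℕ
select (true  ∷ bs) (x ∷ xs) = x ∷ select bs xs
select (false ∷ bs) (x ∷ xs) = select bs xs
select _            _        = []

std : List ℕ → List ℕ
std l = map (λ x → length (filter (_<? x) l)) l

-- subsets of [N] of size k, as characteristic Bool-lists of length N
subsets : ℕ → ℕ → List (List Bool)
subsets zero    zero    = [ [] ]
subsets zero    (suc k) = []
subsets (suc N) zero    = map (false ∷_) (subsets N zero)
subsets (suc N) (suc k) = map (true ∷_) (subsets N k) ++ map (false ∷_) (subsets N (suc k))

insertions : ℕ → List ℕ → List (List ℕ)
insertions x []       = [ [ x ] ]
insertions x (y ∷ ys) = (x ∷ y ∷ ys) ∷ map (y ∷_) (insertions x ys)

perms : ℕ → List (List ℕ)
perms zero    = [ [] ]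
perms (suc n) = concatMap (insertions n) (perms n)

-- Formal linear combinations of permutations (finite lists of terms,
-- the coefficient of σ is the sum of coefficients of the terms equal to σ)

Comb : Set
Comb = List (ℚ × List ℕ)

coeff : List ℕ → Comb → ℚ
coeff σ []             = 0ℚ
coeff σ ((a , τ) ∷ c) = if does (≡-dec ℕ._≟_ σ τ) then a +ℚ coeff σ c else coeff σ c

Constituent : List ℕ → Comb → Set
Constituent σ c = ¬ (coeff σ c ≡ 0ℚ)

countSplits : List ℕ → List ℕ → List ℕ → ℕ
countSplits τ ρ σ =
  length (filter (λ s → ≡-dec ℕ._≟_ (std (select s σ)) τ
                        ×-dec ≡-dec ℕ._≟_ (std (select (map not s) σ)) ρ)
                 (subsets (length σ) (length τ)))

C-pos : ∀ m k → 0 < (k + m) C k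
C-pos m zero = z<s
C-pos zero (suc k) = subst (0 <_) (sym (subst (λ n → n C suc k ≡ 1) (sym (+-identityʳ (suc k))) (nCn≡1 (suc k)))) z<s
C-pos (suc m) (suc k) =
  subst (0 <_) (nCk+nC[k+1]≡[n+1]C[k+1] (k + suc m) k)
        (<-≤-trans (C-pos (suc m) k) (m≤m+n _ _))

prodPerm : List ℕ → List ℕ → Comb
prodPerm τ ρ =
  map (λ σ → ((ℤ+ countSplits τ ρ σ) / ((length τ + length ρ) C length τ))
               {{>-nonZero (C-pos (length ρ) (length τ))}} , σ)
      (perms (length τ + length ρ))

prodComb : Comb → Comb → Comb
prodComb c d =
  concatMap (λ { (a , τ) →
    concatMap (λ { (b , ρ) →
      map (λ { (q , σ) → (a * b * q , σ) }) (prodPerm τ ρ) }) d }) c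

flagProd : List (List ℕ) → Comb
flagProd []       = [ (1ℚ , []) ]
flagProd (p ∷ ps) = foldl (λ acc q → prodComb acc [ (1ℚ , q) ]) [ (1ℚ , p) ] ps

{-# OPTIONS --safe #-}
-- Write σ̄ for the block word of σ. If some positions of σ induce α and the others induce β,
-- every block of σ either lies on one side, where it reappears as a block of α or of β, or
-- is cut and contributes at least one block to each. So |σ̄| ≤ |ᾱ| + |β̄|, with equality
-- only when σ̄ is a shuffle of ᾱ and β̄.
-- Along π₁ × ⋯ × πₖ every constituent τ therefore has τ̄ ≤ x = π̄₁ ⋯ π̄ₖ in shortlex order
-- (length first, then lexicographic): the next word l = π̄ₖ₊₁ is Lyndon and at most each
-- earlier π̄ᵢ, hence at most every nonempty suffix of x, and then every shuffle of l with a
-- word y ≤ x of the same length is at most x l. For σ ≠ π the block words differ, so the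
-- inequality is strict.

module Submission where

open import Algebra.Properties.CommutativeSemigroup as CommutativeSemigroupProperties using ()
open import Data.Bool using (true; false; not)
open import Data.Integer using () renaming (+_ to ℤ+_)
open import Data.List using (List; []; _∷_; [_]; _++_; _∷ʳ_; map; length; filter; concat; concatMap; foldl; upTo; take; drop)
open import Data.List.Membership.Propositional using (_∈_; find)
open import Data.List.Membership.Propositional.Properties using (∈-upTo⁻; ∈-concatMap⁻; ∈-map⁻; ∈-filter⁻; ∈-++⁻)
open import Data.List.Properties using (≡-dec; length-++; length-map; length-upTo; length-take; length-drop; ++-assoc; ++-identityʳ; ++-cancelˡ; ++-conicalˡ; map-++; map-∘; map-cong; map-cong-local; map-id; map-id-local; map-injective; upTo-∷ʳ; take++drop≡id; take-take; take-map; drop-map; filter-++; filter-all; filter-none; filter-some; filter-notAll; filter-accept; filter-reject)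
open import Data.List.Relation.Binary.Lex.Core using (base; halt; this; next)
open import Data.List.Relation.Binary.Lex.Strict using (Lex-<; Lex-≤)
import Data.List.Relation.Binary.Lex.Strict as LexStrict
open import Data.List.Relation.Binary.Permutation.Propositional using (_↭_; ↭-refl; ↭-sym; ↭-trans; prep; swap; module PermutationReasoning)
open import Data.List.Relation.Binary.Permutation.Propositional.Properties using (filter-↭; ↭-length; ∈-resp-↭; ++⁺ʳ; drop-∷; ∷↭∷ʳ)
import Data.List.Relation.Binary.Permutation.Propositional.Properties as ↭
open import Data.List.Relation.Binary.Pointwise using (Pointwise; []; _∷_)
import Data.List.Relation.Binary.Pointwise as Pointwise
open import Data.List.Relation.Ternary.Interleaving.Propositional using (Interleaving; []; consˡ; consʳ; left; right)
open import Data.List.Relation.Ternary.Interleaving.Properties using (interleave-length; ++-disjoint)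
import Data.List.Relation.Ternary.Interleaving.Properties as Interleaving
open import Data.List.Relation.Unary.All as All using (All; []; _∷_)
open import Data.List.Relation.Unary.All.Properties using (¬Any⇒All¬; map⁺) renaming (++⁺ to All-++⁺)
open import Data.List.Relation.Unary.AllPairs using (AllPairs; []; _∷_)
open import Data.List.Relation.Unary.Any using (here; there)
import Data.List.Relation.Unary.Any as Any
open import Data.List.Relation.Unary.Linked using (Linked)
open import Data.List.Relation.Unary.Linked.Properties using (Linked⇒AllPairs)
open import Data.Nat using (ℕ; zero; suc; _+_; _∸_; _⊓_; _<_; _≤_; _<?_; _≤?_; z≤n; s≤s; z<s; NonZero; >-nonZero; <-cmp; anyUpTo?)
import Data.Nat as ℕ
open import Data.Nat.Properties using (+-assoc; +-cancelˡ-<; +-cancelˡ-≡; +-comm; +-commutativeSemigroup; +-identityʳ; +-mono-<-≤; +-mono-≤-<; +-monoʳ-<; +-monoˡ-<; +-monoˡ-≤; +-suc; <-trans; <-≤-trans; <⇒≢; <⇒≤; m+[n∸m]≡n; m+n∸m≡n; m<m+n; m≤m+n; m≤n⇒m⊓n≡m; n≮n; suc-injective; ≤-pred; ≤-refl; ≤-reflexive; ≤-trans; ≤⇒≯; ≮⇒≥)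
open import Data.Product using (∃; ∃₂; ∃-syntax; _×_; _,_; -,_; proj₁; proj₂)
open import Data.Rational using (0ℚ; 1ℚ; _*_; _/_) renaming (_≟_ to _≟ℚ_)
import Data.Rational.Properties as ℚ
open import Data.Sum using (_⊎_; inj₁; inj₂)
open import Data.Unit using (⊤; tt)
open import Function using (_∘_)
open import Level using (0ℓ)
open import Relation.Binary using (Rel; Transitive)
open import Relation.Binary.Definitions using (tri<; tri≈; tri>)
open import Relation.Binary.PropositionalEquality using (_≡_; _≢_; refl; sym; trans; cong; cong₂; subst; subst₂; isEquivalence; resp₂; module ≡-Reasoning)
open import Relation.Nullary using (¬_; yes; no; contradiction)
open import Relation.Nullary.Decidable using (_×-dec_)

open import Defs

-- Shuffles and lexicographic order

module _ {A : Set} where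

  interleaving-++ : ∀ (xs ys : List A) → Interleaving xs ys (xs ++ ys)
  interleaving-++ xs ys = ++-disjoint (left (Pointwise.refl refl)) (right (Pointwise.refl refl))

  interleaving-[]ˡ : ∀ {ys zs : List A} → Interleaving [] ys zs → zs ≡ ys
  interleaving-[]ˡ [] = refl
  interleaving-[]ˡ (consʳ yszs) = cong (_ ∷_) (interleaving-[]ˡ yszs)

  ShuffleOrShorter : List A → List A → List A → Set
  ShuffleOrShorter x y z = length z < length x + length y ⊎ Interleaving x y z

  shuffleOrShorter-≤ : ∀ {x y z} → ShuffleOrShorter x y z → length z ≤ length x + length y
  shuffleOrShorter-≤ (inj₁ z<) = <⇒≤ z<
  shuffleOrShorter-≤ (inj₂ xyz) = ≤-reflexive (interleave-length xyz)

  private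
    length-++-< : ∀ (a b c d u v : List A) → length u + length v < (length a + length b) + (length c + length d) →
                  length (u ++ v) < length (a ++ c) + length (b ++ d)
    length-++-< a b c d u v = subst₂ _<_ (sym (length-++ u)) (sym lengths)
      where
      open CommutativeSemigroupProperties +-commutativeSemigroup using (interchange)
      lengths : length (a ++ c) + length (b ++ d) ≡ (length a + length b) + (length c + length d)
      lengths = trans (cong₂ _+_ (length-++ a) (length-++ b)) (interchange (length a) (length c) (length b) (length d))

  shuffleOrShorter-++ : ∀ {a b c d u v} → ShuffleOrShorter a b u → ShuffleOrShorter c d v →
                        ShuffleOrShorter (a ++ c) (b ++ d) (u ++ v)
  shuffleOrShorter-++ (inj₂ abu) (inj₂ cdv) = inj₂ (Interleaving.++⁺ abu cdv)
  shuffleOrShorter-++ {a} {b} {c} {d} {u} {v} (inj₁ u<) cdv =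
    inj₁ (length-++-< a b c d u v (+-mono-<-≤ u< (shuffleOrShorter-≤ cdv)))
  shuffleOrShorter-++ {a} {b} {c} {d} {u} {v} abu@(inj₂ _) (inj₁ v<) =
    inj₁ (length-++-< a b c d u v (+-mono-≤-< (shuffleOrShorter-≤ abu) v<))

module Shuffles {A : Set} (_≺_ : Rel A 0ℓ) (≺-trans : Transitive _≺_) where

  infix 4 _≤L_ _<L_ _≤Suffixes_ _≤shortlex_ _<shortlex_

  _≤L_ : List A → List A → Set
  _≤L_ = Lex-≤ _≡_ _≺_

  _<L_ : List A → List A → Set
  _<L_ = Lex-< _≡_ _≺_

  ≤L-refl : ∀ {xs} → xs ≤L xs
  ≤L-refl = LexStrict.≤-reflexive _≡_ _≺_ (Pointwise.refl refl)

  ≤L-trans : Transitive _≤L_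
  ≤L-trans = LexStrict.≤-transitive isEquivalence (resp₂ _≺_) ≺-trans

  <L⇒≤L : ∀ {xs ys} → xs <L ys → xs ≤L ys
  <L⇒≤L halt = halt
  <L⇒≤L (this x≺y) = this x≺y
  <L⇒≤L (next refl xs<ys) = next refl (<L⇒≤L xs<ys)

  ≤L⇒≡⊎<L : ∀ {xs ys} → xs ≤L ys → xs ≡ ys ⊎ xs <L ys
  ≤L⇒≡⊎<L (base _) = inj₁ refl
  ≤L⇒≡⊎<L halt = inj₂ halt
  ≤L⇒≡⊎<L (this x≺y) = inj₂ (this x≺y)
  ≤L⇒≡⊎<L (next refl xs≤ys) with ≤L⇒≡⊎<L xs≤ys
  ... | inj₁ refl = inj₁ refl
  ... | inj₂ xs<ys = inj₂ (next refl xs<ys)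

  ≤L-++ʳ : ∀ {xs ys} zs → xs ≤L ys → xs ≤L ys ++ zs
  ≤L-++ʳ [] (base _) = base tt
  ≤L-++ʳ (_ ∷ _) (base _) = halt
  ≤L-++ʳ zs halt = halt
  ≤L-++ʳ zs (this x≺y) = this x≺y
  ≤L-++ʳ zs (next refl xs≤ys) = next refl (≤L-++ʳ zs xs≤ys)

  _≤Suffixes_ : List A → List A → Set
  l ≤Suffixes [] = ⊤
  l ≤Suffixes (c ∷ x) = l ≤L c ∷ x × l ≤Suffixes x

  ≤Suffixes-antimono : ∀ {l l′} x → l′ ≤L l → l ≤Suffixes x → l′ ≤Suffixes x
  ≤Suffixes-antimono [] _ _ = tt
  ≤Suffixes-antimono (c ∷ x) l′≤l (l≤cx , l≤x) = ≤L-trans l′≤l l≤cx , ≤Suffixes-antimono x l′≤l l≤x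

  ≤Suffixes-++ : ∀ {l} x y → l ≤Suffixes x → l ≤Suffixes y → l ≤Suffixes x ++ y
  ≤Suffixes-++ [] y _ l≤y = l≤y
  ≤Suffixes-++ (c ∷ x) y (l≤cx , l≤x) l≤y = ≤L-++ʳ y l≤cx , ≤Suffixes-++ x y l≤x l≤y

  IsLyndon : List A → Set
  IsLyndon w = w ≢ [] × (∀ p s → p ≢ [] → s ≢ [] → w ≡ p ++ s → w <L s)

  lyndon⇒≤Suffixes : ∀ {l w} → IsLyndon w → l ≤L w → l ≤Suffixes w
  lyndon⇒≤Suffixes {l} {w} (_ , w<suffixes) l≤w = ≤Suffixes-antimono w l≤w (suffixes [] w refl)
    where
    suffixes : ∀ p s → w ≡ p ++ s → w ≤Suffixes s
    suffixes p [] _ = tt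
    suffixes [] (c ∷ s) refl = ≤L-refl , suffixes [ c ] s refl
    suffixes p@(_ ∷ _) (c ∷ s) refl =
      <L⇒≤L (w<suffixes p (c ∷ s) (λ ()) (λ ()) refl) , suffixes (p ++ [ c ]) s (sym (++-assoc p [ c ] s))

  -- Since y ≤ x, handing the prefix u over from the left word to the right one can only
  -- make an interleaving lexicographically larger.
  interleaving-exchange : ∀ u {x y z} → y ≤L x → Interleaving (u ++ x) y z →
                          ∃[ w ] Interleaving x (u ++ y) w × z ≤L w
  interleaving-exchange [] y≤x xyz = -, xyz , ≤L-refl
  interleaving-exchange (c ∷ u) y≤x (consˡ uxyz) =
    let w , xuyw , z≤w = interleaving-exchange u y≤x uxyz in c ∷ w , consʳ xuyw , next refl z≤w
  interleaving-exchange (c ∷ u) {[]} () (consʳ _)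
  interleaving-exchange (c ∷ u) {e ∷ x} {a ∷ y} (this a≺e) (consʳ _) =
    -, interleaving-++ (e ∷ x) (c ∷ u ++ a ∷ y) , this a≺e
  interleaving-exchange (c ∷ u) {e ∷ x} {e ∷ y} {e ∷ z} (next refl y≤x) (consʳ cuexyz) =
    let w , xuyw , z≤w = interleaving-exchange (c ∷ u ++ [ e ]) y≤x
                           (subst (λ t → Interleaving t y z) (sym (++-assoc (c ∷ u) [ e ] x)) cuexyz)
    in e ∷ w , consˡ (subst (λ t → Interleaving x t w) (++-assoc (c ∷ u) [ e ] y) xuyw) , next refl z≤w

  interleaving-uncons : ∀ {c x y z} → y ≤L c ∷ x → Interleaving (c ∷ x) y z →
                        ∃[ w ] Interleaving x y w × z ≤L c ∷ w
  interleaving-uncons _ (consˡ xyz) = -, xyz , ≤L-refl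
  interleaving-uncons {x = x} {a ∷ y} (this a≺c) (consʳ _) = -, interleaving-++ x (a ∷ y) , this a≺c
  interleaving-uncons {c} (next refl y≤x) (consʳ cxyz) =
    let w , xcyw , z≤w = interleaving-exchange [ c ] y≤x cxyz in w , xcyw , next refl z≤w

  interleaving-≤-++ : ∀ x {l z} → l ≤Suffixes x → Interleaving x l z → z ≤L x ++ l
  interleaving-≤-++ [] _ lz = subst (_≤L _) (sym (interleaving-[]ˡ lz)) ≤L-refl
  interleaving-≤-++ (c ∷ x) (l≤cx , l≤x) cxlz =
    let w , xlw , z≤cw = interleaving-uncons l≤cx cxlz
    in ≤L-trans z≤cw (next refl (interleaving-≤-++ x l≤x xlw))

  interleaving-mono : ∀ {y y′ l z} → length y ≡ length y′ → y ≤L y′ → Interleaving y l z →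
                      ∃[ z′ ] Interleaving y′ l z′ × z ≤L z′
  interleaving-mono {y′ = []} _ _ [] = -, [] , ≤L-refl
  interleaving-mono {y′ = y′@(c ∷ _)} {l} _ (this a≺c) (consˡ _) = -, interleaving-++ y′ l , this a≺c
  interleaving-mono {y′ = _ ∷ _} |y|≡ (next refl y≤y′) (consˡ ylz) =
    let z′ , y′lz′ , z≤z′ = interleaving-mono (suc-injective |y|≡) y≤y′ ylz
    in -, consˡ y′lz′ , next refl z≤z′
  interleaving-mono |y|≡ y≤y′ (consʳ ylz) =
    let z′ , y′lz′ , z≤z′ = interleaving-mono |y|≡ y≤y′ ylz in -, consʳ y′lz′ , next refl z≤z′

  _≤shortlex_ : List A → List A → Set
  u ≤shortlex v = length u < length v ⊎ (length u ≡ length v × u ≤L v)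

  _<shortlex_ : List A → List A → Set
  u <shortlex v = length u < length v ⊎ (length u ≡ length v × u <L v)

  ≤shortlex-refl : ∀ {u} → u ≤shortlex u
  ≤shortlex-refl = inj₂ (refl , ≤L-refl)

  ≤shortlex⇒length-≤ : ∀ {u v} → u ≤shortlex v → length u ≤ length v
  ≤shortlex⇒length-≤ (inj₁ |u|<) = <⇒≤ |u|<
  ≤shortlex⇒length-≤ (inj₂ (|u|≡ , _)) = ≤-reflexive |u|≡

  ≤shortlex∧≢⇒<shortlex : ∀ {u v} → u ≤shortlex v → u ≢ v → u <shortlex v
  ≤shortlex∧≢⇒<shortlex (inj₁ |u|<) _ = inj₁ |u|<
  ≤shortlex∧≢⇒<shortlex (inj₂ (|u|≡ , u≤v)) u≢v with ≤L⇒≡⊎<L u≤v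
  ... | inj₁ u≡v = contradiction u≡v u≢v
  ... | inj₂ u<v = inj₂ (|u|≡ , u<v)

  shuffleOrShorter-≤shortlex : ∀ x {y l z} → l ≤Suffixes x → y ≤shortlex x → ShuffleOrShorter y l z →
                               z ≤shortlex x ++ l
  shuffleOrShorter-≤shortlex x {y} {l} {z} l≤x y≤x (inj₁ |z|<) =
    inj₁ (subst (length z <_) (sym (length-++ x)) (<-≤-trans |z|< (+-monoˡ-≤ (length l) (≤shortlex⇒length-≤ y≤x))))
  shuffleOrShorter-≤shortlex x {l = l} {z} l≤x (inj₁ |y|<) (inj₂ ylz) =
    inj₁ (subst₂ _<_ (sym (interleave-length ylz)) (sym (length-++ x)) (+-monoˡ-< (length l) |y|<))
  shuffleOrShorter-≤shortlex x {l = l} {z} l≤x (inj₂ (|y|≡ , y≤x)) (inj₂ ylz) =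
    let z′ , xlz′ , z≤z′ = interleaving-mono |y|≡ y≤x ylz
    in inj₂ ( trans (interleave-length ylz) (trans (cong (_+ length l) |y|≡) (sym (length-++ x)))
            , ≤L-trans z≤z′ (interleaving-≤-++ x l≤x xlz′))

-- Ranks, standardisation and direct sums

-- Defs' std l unfolds to map (λ x → rank x l) l.
rank : ℕ → List ℕ → ℕ
rank x l = length (filter (_<? x) l)

rank-++ : ∀ x a b → rank x (a ++ b) ≡ rank x a + rank x b
rank-++ x a b = trans (cong length (filter-++ (_<? x) a b)) (length-++ (filter (_<? x) a))

rank-all : ∀ {x a} → All (_< x) a → rank x a ≡ length a
rank-all {x} a<x = cong length (filter-all (_<? x) a<x)

rank-none : ∀ {x a} → All (x ≤_) a → rank x a ≡ 0
rank-none {x} x≤a = cong length (filter-none (_<? x) (All.map ≤⇒≯ x≤a))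

rank≡0⇒ : ∀ {x} a → rank x a ≡ 0 → All (x ≤_) a
rank≡0⇒ {x} a rank≡0 = All.map ≮⇒≥ (¬Any⇒All¬ a (λ any → <⇒≢ (filter-some (_<? x) any) (sym rank≡0)))

rank-↭ : ∀ x {a b} → a ↭ b → rank x a ≡ rank x b
rank-↭ x a↭b = ↭-length (filter-↭ (_<? x) a↭b)

rank-map-+ : ∀ k x a → rank (k + x) (map (k +_) a) ≡ rank x a
rank-map-+ k x [] = refl
rank-map-+ k x (y ∷ a) with y <? x
... | yes y<x = begin
  rank (k + x) (k + y ∷ map (k +_) a) ≡⟨ cong length (filter-accept (_<? k + x) (+-monoʳ-< k y<x)) ⟩
  suc (rank (k + x) (map (k +_) a))   ≡⟨ cong suc (rank-map-+ k x a) ⟩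
  suc (rank x a)                      ≡⟨ cong length (filter-accept (_<? x) y<x) ⟨
  rank x (y ∷ a)                      ∎ where open ≡-Reasoning
... | no y≮x = begin
  rank (k + x) (k + y ∷ map (k +_) a) ≡⟨ cong length (filter-reject (_<? k + x) (y≮x ∘ +-cancelˡ-< k y x)) ⟩
  rank (k + x) (map (k +_) a)         ≡⟨ rank-map-+ k x a ⟩
  rank x a                            ≡⟨ cong length (filter-reject (_<? x) y≮x) ⟨
  rank x (y ∷ a)                      ∎ where open ≡-Reasoning

upTo-+ : ∀ k m → upTo (k + m) ≡ upTo k ++ map (k +_) (upTo m)
upTo-+ k zero = trans (cong upTo (+-identityʳ k)) (sym (++-identityʳ (upTo k)))
upTo-+ k (suc m) = begin
  upTo (k + suc m)                                ≡⟨ cong upTo (+-suc k m) ⟩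
  upTo (suc (k + m))                              ≡⟨ upTo-∷ʳ (k + m) ⟨
  upTo (k + m) ∷ʳ (k + m)                         ≡⟨ cong (_∷ʳ (k + m)) (upTo-+ k m) ⟩
  (upTo k ++ map (k +_) (upTo m)) ++ [ k + m ]    ≡⟨ ++-assoc (upTo k) _ _ ⟩
  upTo k ++ (map (k +_) (upTo m) ++ [ k + m ])    ≡⟨ cong (upTo k ++_) (map-++ (k +_) (upTo m) [ m ]) ⟨
  upTo k ++ map (k +_) (upTo m ∷ʳ m)              ≡⟨ cong (λ ms → upTo k ++ map (k +_) ms) (upTo-∷ʳ m) ⟩
  upTo k ++ map (k +_) (upTo (suc m))             ∎
  where open ≡-Reasoning

upTo-< : ∀ n → All (_< n) (upTo n)
upTo-< n = All.tabulate ∈-upTo⁻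

map-+-≥ : ∀ k l → All (k ≤_) (map (k +_) l)
map-+-≥ k l = map⁺ (All.tabulate (λ {x} _ → m≤m+n k x))

filter-<-++-map-+ : ∀ {k u} v → All (_< k) u → filter (_<? k) (u ++ map (k +_) v) ≡ u
filter-<-++-map-+ {k} {u} v u<k = begin
  filter (_<? k) (u ++ map (k +_) v)                    ≡⟨ filter-++ (_<? k) u _ ⟩
  filter (_<? k) u ++ filter (_<? k) (map (k +_) v)     ≡⟨ cong₂ _++_ (filter-all (_<? k) u<k)
                                                                      (filter-none (_<? k) (All.map ≤⇒≯ (map-+-≥ k v))) ⟩
  u ++ []                                               ≡⟨ ++-identityʳ u ⟩
  u                                                     ∎
  where open ≡-Reasoning

filter-<-upTo-+ : ∀ k m → filter (_<? k) (upTo (k + m)) ≡ upTo k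
filter-<-upTo-+ k m = trans (cong (filter (_<? k)) (upTo-+ k m)) (filter-<-++-map-+ (upTo m) (upTo-< k))

rank-upTo : ∀ {x n} → x ≤ n → rank x (upTo n) ≡ x
rank-upTo {x} {n} x≤n = begin
  rank x (upTo n)              ≡⟨ cong (rank x ∘ upTo) (m+[n∸m]≡n x≤n) ⟨
  rank x (upTo (x + (n ∸ x)))  ≡⟨ cong length (filter-<-upTo-+ x (n ∸ x)) ⟩
  length (upTo x)              ≡⟨ length-upTo x ⟩
  x                            ∎
  where open ≡-Reasoning

rank-< : ∀ {x l} → x ∈ l → rank x l < length l
rank-< {x} {l} x∈l = filter-notAll (_<? x) l (Any.map (λ {refl → n≮n x}) x∈l)

isPerm-< : ∀ {u} → IsPerm u → All (_< length u) u
isPerm-< u↭ = All.tabulate (∈-upTo⁻ ∘ ∈-resp-↭ u↭)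

⊕-length : ∀ u v → length (u ⊕ v) ≡ length u + length v
⊕-length u v = trans (length-++ u) (cong (length u +_) (length-map _ v))

upTo-length-⊕ : ∀ u v → upTo (length (u ⊕ v)) ≡ upTo (length u) ++ map (length u +_) (upTo (length v))
upTo-length-⊕ u v = trans (cong upTo (⊕-length u v)) (upTo-+ (length u) (length v))

isPerm-⊕ : ∀ {u v} → IsPerm u → IsPerm v → IsPerm (u ⊕ v)
isPerm-⊕ {u} {v} u↭ v↭ = subst (u ⊕ v ↭_) (sym (upTo-length-⊕ u v)) (↭.++⁺ u↭ (↭.map⁺ (length u +_) v↭))

↭-++-cancelˡ : ∀ xs {ys zs : List ℕ} → xs ++ ys ↭ xs ++ zs → ys ↭ zs
↭-++-cancelˡ [] ys↭zs = ys↭zs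
↭-++-cancelˡ (x ∷ xs) xxs↭ = ↭-++-cancelˡ xs (drop-∷ xxs↭)

map-∸-+ : ∀ k l → map (_∸ k) (map (k +_) l) ≡ l
map-∸-+ k l = trans (sym (map-∘ l)) (trans (map-cong (m+n∸m≡n k) l) (map-id l))

⊕-isPerm⁻ : ∀ {u v} → All (_< length u) u → IsPerm (u ⊕ v) → IsPerm u × IsPerm v
⊕-isPerm⁻ {u} {v} u<k uv↭ = u↭ , v↭
  where
  k = length u
  uv↭′ : u ⊕ v ↭ upTo k ++ map (k +_) (upTo (length v))
  uv↭′ = subst (u ⊕ v ↭_) (upTo-length-⊕ u v) uv↭
  u↭ : IsPerm u
  u↭ = subst₂ _↭_ (filter-<-++-map-+ v u<k) (filter-<-++-map-+ (upTo (length v)) (upTo-< k)) (filter-↭ (_<? k) uv↭′)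
  v↭ : IsPerm v
  v↭ = subst₂ _↭_ (map-∸-+ k v) (map-∸-+ k (upTo (length v)))
         (↭.map⁺ (_∸ k) (↭-++-cancelˡ (upTo k) (↭-trans (++⁺ʳ _ (↭-sym u↭)) uv↭′)))

map-+-∸ : ∀ {k l} → All (k ≤_) l → map (k +_) (map (_∸ k) l) ≡ l
map-+-∸ {k} {l} k≤l = trans (sym (map-∘ l)) (map-id-local (All.map m+[n∸m]≡n k≤l))

⊕-split : ∀ {k w} → IsPerm w → k ≤ length w → All (_< k) (take k w) →
          ∃₂ λ u v → IsPerm u × IsPerm v × length u ≡ k × w ≡ u ⊕ v
⊕-split {k} {w} w↭ k≤n prefix<k = u , v , proj₁ uv↭ , proj₂ uv↭ , |u|≡k , w≡u⊕v
  where
  u = take k w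
  rest = drop k w
  v = map (_∸ k) rest
  |u|≡k : length u ≡ k
  |u|≡k = trans (length-take k w) (m≤n⇒m⊓n≡m k≤n)
  rank-w : k + rank k rest ≡ k + 0
  rank-w = begin
    k + rank k rest             ≡⟨ cong (_+ rank k rest) (trans (rank-all prefix<k) |u|≡k) ⟨
    rank k u + rank k rest      ≡⟨ rank-++ k u rest ⟨
    rank k (u ++ rest)          ≡⟨ cong (rank k) (take++drop≡id k w) ⟩
    rank k w                    ≡⟨ rank-↭ k w↭ ⟩
    rank k (upTo (length w))    ≡⟨ rank-upTo k≤n ⟩
    k                           ≡⟨ +-identityʳ k ⟨
    k + 0                       ∎
    where open ≡-Reasoning
  w≡u⊕v : w ≡ u ⊕ v
  w≡u⊕v = begin
    w                           ≡⟨ take++drop≡id k w ⟨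
    u ++ rest                   ≡⟨ cong (u ++_) (map-+-∸ (rank≡0⇒ rest (+-cancelˡ-≡ k _ _ rank-w))) ⟨
    u ++ map (k +_) v           ≡⟨ cong (λ n → u ++ map (n +_) v) |u|≡k ⟨
    u ⊕ v                       ∎
    where open ≡-Reasoning
  uv↭ : IsPerm u × IsPerm v
  uv↭ = ⊕-isPerm⁻ (subst (λ n → All (_< n) u) (sym |u|≡k) prefix<k) (subst IsPerm w≡u⊕v w↭)

⊕-assoc : ∀ u v w → (u ⊕ v) ⊕ w ≡ u ⊕ (v ⊕ w)
⊕-assoc u v w = begin
  (u ++ map (length u +_) v) ++ map (length (u ⊕ v) +_) w                    ≡⟨ ++-assoc u _ _ ⟩
  u ++ (map (length u +_) v ++ map (length (u ⊕ v) +_) w)                    ≡⟨ cong (λ n → u ++ (map (length u +_) v ++ map (n +_) w)) (⊕-length u v) ⟩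
  u ++ (map (length u +_) v ++ map ((length u + length v) +_) w)             ≡⟨ cong (λ ws → u ++ (map (length u +_) v ++ ws)) (map-+-+ w) ⟩
  u ++ (map (length u +_) v ++ map (length u +_) (map (length v +_) w))      ≡⟨ cong (u ++_) (map-++ (length u +_) v _) ⟨
  u ⊕ (v ⊕ w)                                                                ∎
  where
  open ≡-Reasoning
  map-+-+ : ∀ l → map ((length u + length v) +_) l ≡ map (length u +_) (map (length v +_) l)
  map-+-+ l = trans (map-cong (+-assoc (length u) (length v)) l) (map-∘ l)

⊕-all-++ : ∀ us vs → ⊕-all (us ++ vs) ≡ ⊕-all us ⊕ ⊕-all vs
⊕-all-++ [] vs = sym (map-id (⊕-all vs))
⊕-all-++ (u ∷ us) vs = trans (cong (u ⊕_) (⊕-all-++ us vs)) (sym (⊕-assoc u (⊕-all us) (⊕-all vs)))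

length-std : ∀ l → length (std l) ≡ length l
length-std l = length-map _ l

std-< : ∀ l → All (_< length (std l)) (std l)
std-< l = subst (λ n → All (_< n) (std l)) (sym (length-std l)) (map⁺ (All.tabulate rank-<))

std-[]⁻ : ∀ {l} → std l ≡ [] → l ≡ []
std-[]⁻ {[]} _ = refl
std-[]⁻ {_ ∷ _} ()

std-isPerm : ∀ {w} → IsPerm w → std w ≡ w
std-isPerm {w} w↭ = map-id-local (All.map (λ {x} x<n → trans (rank-↭ x w↭) (rank-upTo (<⇒≤ x<n))) (isPerm-< w↭))

std-map-+ : ∀ k l → std (map (k +_) l) ≡ std l
std-map-+ k l = trans (sym (map-∘ l)) (map-cong (λ y → rank-map-+ k y l) l)

std-++ : ∀ {k} X Z → All (_< k) X → All (k ≤_) Z → std (X ++ Z) ≡ std X ⊕ std Z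
std-++ {k} X Z X<k k≤Z = begin
  map (λ x → rank x (X ++ Z)) (X ++ Z)                                   ≡⟨ map-++ _ X Z ⟩
  map (λ x → rank x (X ++ Z)) X ++ map (λ z → rank z (X ++ Z)) Z         ≡⟨ cong₂ _++_ (map-cong-local (All.map rank-X X<k))
                                                                                         (map-cong-local (All.map rank-Z k≤Z)) ⟩
  std X ++ map (λ z → length X + rank z Z) Z                             ≡⟨ cong (std X ++_) (map-∘ Z) ⟩
  std X ++ map (length X +_) (std Z)                                     ≡⟨ cong (λ n → std X ++ map (n +_) (std Z)) (length-std X) ⟨
  std X ⊕ std Z                                                          ∎
  where
  open ≡-Reasoning
  rank-X : ∀ {x} → x < k → rank x (X ++ Z) ≡ rank x X
  rank-X {x} x<k =
    trans (rank-++ x X Z) (trans (cong (rank x X +_) (rank-none (All.map (≤-trans (<⇒≤ x<k)) k≤Z))) (+-identityʳ _))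
  rank-Z : ∀ {z} → k ≤ z → rank z (X ++ Z) ≡ length X + rank z Z
  rank-Z {z} k≤z = trans (rank-++ z X Z) (cong (_+ rank z Z) (rank-all (All.map (λ x<k → <-≤-trans x<k k≤z) X<k)))

-- Block words

≢[]⇒0<length : ∀ {A : Set} {l : List A} → l ≢ [] → 0 < length l
≢[]⇒0<length {l = []} l≢[] = contradiction refl l≢[]
≢[]⇒0<length {l = _ ∷ _} _ = z<s

0<length⇒≢[] : ∀ {A : Set} {l : List A} → 0 < length l → l ≢ []
0<length⇒≢[] 0<0 refl = n≮n 0 0<0

take-length-++ : ∀ (xs ys : List ℕ) → take (length xs) (xs ++ ys) ≡ xs
take-length-++ [] ys = refl
take-length-++ (x ∷ xs) ys = cong (x ∷_) (take-length-++ xs ys)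

⊕-injective : ∀ {u u′ v v′} → length u ≡ length u′ → u ⊕ v ≡ u′ ⊕ v′ → u ≡ u′ × v ≡ v′
⊕-injective {u} {u′} {v} {v′} |u|≡ eq = u≡u′ , map-injective (+-cancelˡ-≡ (length u) _ _) (++-cancelˡ u _ _ eq′)
  where
  u≡u′ : u ≡ u′
  u≡u′ = begin
    u                           ≡⟨ take-length-++ u _ ⟨
    take (length u) (u ⊕ v)     ≡⟨ cong (take (length u)) eq ⟩
    take (length u) (u′ ⊕ v′)   ≡⟨ cong (λ n → take n (u′ ⊕ v′)) |u|≡ ⟩
    take (length u′) (u′ ⊕ v′)  ≡⟨ take-length-++ u′ _ ⟩
    u′                          ∎
    where open ≡-Reasoning
  eq′ : u ⊕ v ≡ u ⊕ v′
  eq′ = trans eq (cong (_⊕ v′) (sym u≡u′))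

blockWord⇒isPerm : ∀ {w bs} → BlockWord w bs → IsPerm w
blockWord⇒isPerm {bs = []} (_ , refl) = ↭-refl
blockWord⇒isPerm {bs = b ∷ bs} ((b-ind ∷ bs-ind) , refl) = isPerm-⊕ (proj₁ b-ind) (blockWord⇒isPerm (bs-ind , refl))

blockWord-[]⁻ : ∀ {bs} → BlockWord [] bs → bs ≡ []
blockWord-[]⁻ {[]} _ = refl
blockWord-[]⁻ {b ∷ bs} ((b-ind ∷ _) , eq) = contradiction (++-conicalˡ b _ (sym eq)) (proj₁ (proj₂ b-ind))

blockWord-⊕ : ∀ {u v bu bv} → BlockWord u bu → BlockWord v bv → BlockWord (u ⊕ v) (bu ++ bv)
blockWord-⊕ {bu = bu} {bv} (bu-ind , refl) (bv-ind , refl) = All-++⁺ bu-ind bv-ind , sym (⊕-all-++ bu bv)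

blockWord-single : ∀ {B} → Indecomposable B → BlockWord B [ B ]
blockWord-single {B} B-ind = (B-ind ∷ []) , sym (++-identityʳ B)

blockWord-⊕-all : ∀ {ps bss} → Pointwise BlockWord ps bss → BlockWord (⊕-all ps) (concat bss)
blockWord-⊕-all [] = [] , refl
blockWord-⊕-all (p-bw ∷ ps-bw) = blockWord-⊕ p-bw (blockWord-⊕-all ps-bw)

⊕-length-<ˡ : ∀ u {v} → v ≢ [] → length u < length (u ⊕ v)
⊕-length-<ˡ u {v} v≢[] = subst (length u <_) (sym (⊕-length u v)) (m<m+n (length u) (≢[]⇒0<length v≢[]))

⊕-length-<ʳ : ∀ {u} v → u ≢ [] → length v < length (u ⊕ v)
⊕-length-<ʳ {u} v u≢[] =
  subst (length v <_) (sym (trans (⊕-length u v) (+-comm (length u) (length v)))) (m<m+n (length v) (≢[]⇒0<length u≢[]))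

<length-⊕⇒≢[] : ∀ u {v} → length u < length (u ⊕ v) → v ≢ []
<length-⊕⇒≢[] u |u|< refl = n≮n (length u) (subst (length u <_) (cong length (++-identityʳ u)) |u|<)

take-⊕-≤ : ∀ {b b′ R R′} → b ⊕ R ≡ b′ ⊕ R′ → length b ≤ length b′ → take (length b) b′ ≡ b
take-⊕-≤ {b} {b′} {R} {R′} eq |b|≤|b′| = begin
  take k b′                            ≡⟨ cong (take k) (take-length-++ b′ _) ⟨
  take k (take (length b′) (b′ ⊕ R′))  ≡⟨ take-take k (length b′) _ ⟩
  take (k ⊓ length b′) (b′ ⊕ R′)       ≡⟨ cong (λ n → take n (b′ ⊕ R′)) (m≤n⇒m⊓n≡m |b|≤|b′|) ⟩
  take k (b′ ⊕ R′)                     ≡⟨ cong (take k) eq ⟨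
  take k (b ⊕ R)                       ≡⟨ take-length-++ b _ ⟩
  b                                    ∎
  where
  open ≡-Reasoning
  k = length b

-- If b were shorter, the first length b entries of the indecomposable b′ would
-- be those of b, i.e. below length b, and b′ would split there.
first-block-≮ : ∀ {b b′ R R′} → Indecomposable b → Indecomposable b′ → b ⊕ R ≡ b′ ⊕ R′ → ¬ length b < length b′
first-block-≮ {b} {b′} (b↭ , b≢[] , _) (b′↭ , _ , b′-indec) eq |b|<|b′|
  with ⊕-split b′↭ (<⇒≤ |b|<|b′|) (subst (All (_< length b)) (sym (take-⊕-≤ eq (<⇒≤ |b|<|b′|))) (isPerm-< b↭))
... | u , v , u↭ , v↭ , |u|≡|b| , b′≡u⊕v = b′-indec u v u↭ v↭ u≢[] v≢[] b′≡u⊕v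
  where
  u≢[] : u ≢ []
  u≢[] = 0<length⇒≢[] (subst (0 <_) (sym |u|≡|b|) (≢[]⇒0<length b≢[]))
  v≢[] : v ≢ []
  v≢[] = <length-⊕⇒≢[] u (subst₂ _<_ (sym |u|≡|b|) (cong length b′≡u⊕v) |b|<|b′|)

blockWord-unique : ∀ {w} bs bs′ → BlockWord w bs → BlockWord w bs′ → bs ≡ bs′
blockWord-unique [] [] _ _ = refl
blockWord-unique [] (b′ ∷ _) (_ , refl) ((b′-ind ∷ _) , eq′) = contradiction (++-conicalˡ b′ _ (sym eq′)) (proj₁ (proj₂ b′-ind))
blockWord-unique (b ∷ _) [] ((b-ind ∷ _) , eq) (_ , refl) = contradiction (++-conicalˡ b _ (sym eq)) (proj₁ (proj₂ b-ind))
blockWord-unique (b ∷ r) (b′ ∷ r′) ((b-ind ∷ r-ind) , refl) ((b′-ind ∷ r′-ind) , eq)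
  with <-cmp (length b) (length b′)
... | tri< |b|< _ _ = contradiction |b|< (first-block-≮ b-ind b′-ind eq)
... | tri> _ _ |b′|< = contradiction |b′|< (first-block-≮ b′-ind b-ind (sym eq))
... | tri≈ _ |b|≡ _ with ⊕-injective {b} {b′} |b|≡ eq
...   | refl , rest≡ = cong (b ∷_) (blockWord-unique r r′ (r-ind , refl) (r′-ind , rest≡))

indecomposable-or-⊕ : ∀ {w} → IsPerm w → w ≢ [] →
  Indecomposable w ⊎ ∃₂ λ u v → IsPerm u × IsPerm v × u ≢ [] × v ≢ [] × w ≡ u ⊕ v
indecomposable-or-⊕ {w} w↭ w≢[] with anyUpTo? (λ k → (1 ≤? k) ×-dec All.all? (_<? k) (take k w)) (length w)
... | yes (k , k<n , 1≤k , prefix<k) with ⊕-split w↭ (<⇒≤ k<n) prefix<k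
...   | u , v , u↭ , v↭ , |u|≡k , w≡u⊕v = inj₂ (u , v , u↭ , v↭ , u≢[] , v≢[] , w≡u⊕v)
  where
  u≢[] : u ≢ []
  u≢[] = 0<length⇒≢[] (subst (0 <_) (sym |u|≡k) 1≤k)
  v≢[] : v ≢ []
  v≢[] = <length-⊕⇒≢[] u (subst₂ _<_ (sym |u|≡k) (cong length w≡u⊕v) k<n)
indecomposable-or-⊕ {w} w↭ w≢[] | no no-split = inj₁ (w↭ , w≢[] , indec)
  where
  indec : ∀ u v → IsPerm u → IsPerm v → u ≢ [] → v ≢ [] → w ≢ u ⊕ v
  indec u v u↭ v↭ u≢[] v≢[] refl =
    no-split ( length u , ⊕-length-<ˡ u v≢[] , ≢[]⇒0<length u≢[]
             , subst (All (_< length u)) (sym (take-length-++ u _)) (isPerm-< u↭))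

blockWord-exists : ∀ {w} → IsPerm w → ∃ (BlockWord w)
blockWord-exists w↭ = bounded _ ≤-refl w↭
  where
  bounded : ∀ n {w} → length w ≤ n → IsPerm w → ∃ (BlockWord w)
  bounded _ {[]} _ _ = -, [] , refl
  bounded (suc n) {w@(_ ∷ _)} (s≤s |w|≤n) w↭ with indecomposable-or-⊕ w↭ (λ ())
  ... | inj₁ w-ind = -, blockWord-single w-ind
  ... | inj₂ (u , v , u↭ , v↭ , u≢[] , v≢[] , w≡u⊕v) =
    subst (λ x → ∃ (BlockWord x)) (sym w≡u⊕v)
      (-, blockWord-⊕ (proj₂ (bounded n (shorter (⊕-length-<ˡ u v≢[])) u↭))
                      (proj₂ (bounded n (shorter (⊕-length-<ʳ v u≢[])) v↭)))
    where
    shorter : ∀ {m} → m < length (u ⊕ v) → m ≤ n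
    shorter m< = ≤-pred (≤-trans m< (subst (λ x → length x ≤ suc n) w≡u⊕v (s≤s |w|≤n)))

⊕-blockWord⁻ : ∀ {u v b} → All (_< length u) u → BlockWord (u ⊕ v) b →
               ∃₂ λ bu bv → BlockWord u bu × BlockWord v bv × b ≡ bu ++ bv
⊕-blockWord⁻ u<|u| uv-bw with ⊕-isPerm⁻ u<|u| (blockWord⇒isPerm uv-bw)
... | u↭ , v↭ with blockWord-exists u↭ | blockWord-exists v↭
...   | bu , u-bw | bv , v-bw = bu , bv , u-bw , v-bw , blockWord-unique _ _ uv-bw (blockWord-⊕ u-bw v-bw)

-- Patterns of direct sums

select-[] : ∀ s → select s [] ≡ []
select-[] [] = refl
select-[] (true ∷ s) = refl
select-[] (false ∷ s) = refl

select-++ : ∀ s x y → select s (x ++ y) ≡ select (take (length x) s) x ++ select (drop (length x) s) y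
select-++ [] [] y = refl
select-++ (true ∷ s) [] y = refl
select-++ (false ∷ s) [] y = refl
select-++ [] (a ∷ x) y = refl
select-++ (true ∷ s) (a ∷ x) y = cong (a ∷_) (select-++ s x y)
select-++ (false ∷ s) (a ∷ x) y = select-++ s x y

select-map : ∀ (f : ℕ → ℕ) s y → select s (map f y) ≡ map f (select s y)
select-map f [] [] = refl
select-map f [] (a ∷ y) = refl
select-map f (true ∷ s) [] = refl
select-map f (false ∷ s) [] = refl
select-map f (true ∷ s) (a ∷ y) = cong (f a ∷_) (select-map f s y)
select-map f (false ∷ s) (a ∷ y) = select-map f s y

select-All : ∀ {P : ℕ → Set} s {y} → All P y → All P (select s y)
select-All [] [] = []
select-All [] (_ ∷ _) = []
select-All (true ∷ s) [] = []
select-All (false ∷ s) [] = []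
select-All (true ∷ s) (pa ∷ py) = pa ∷ select-All s py
select-All (false ∷ s) (pa ∷ py) = select-All s py

select-≡[]⇒complement : ∀ s y → length s ≡ length y → select s y ≡ [] → select (map not s) y ≡ y
select-≡[]⇒complement [] [] _ _ = refl
select-≡[]⇒complement (false ∷ s) (a ∷ y) |s|≡ sel≡[] = cong (a ∷_) (select-≡[]⇒complement s y (suc-injective |s|≡) sel≡[])

complement-≡[]⇒select : ∀ s y → length s ≡ length y → select (map not s) y ≡ [] → select s y ≡ y
complement-≡[]⇒select [] [] _ _ = refl
complement-≡[]⇒select (true ∷ s) (a ∷ y) |s|≡ sel≡[] = cong (a ∷_) (complement-≡[]⇒select s y (suc-injective |s|≡) sel≡[])

std-select-⊕ : ∀ s {B} R → All (_< length B) B →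
               std (select s (B ⊕ R)) ≡ std (select (take (length B) s) B) ⊕ std (select (drop (length B) s) R)
std-select-⊕ s {B} R B<k = begin
  std (select s (B ++ map (k +_) R))                                  ≡⟨ cong std (select-++ s B (map (k +_) R)) ⟩
  std (select s₁ B ++ select s₂ (map (k +_) R))                       ≡⟨ cong (λ Y → std (select s₁ B ++ Y)) (select-map (k +_) s₂ R) ⟩
  std (select s₁ B ++ map (k +_) (select s₂ R))                       ≡⟨ std-++ _ _ (select-All s₁ B<k) (map-+-≥ k (select s₂ R)) ⟩
  std (select s₁ B) ⊕ std (map (k +_) (select s₂ R))                  ≡⟨ cong (std (select s₁ B) ⊕_) (std-map-+ k (select s₂ R)) ⟩
  std (select s₁ B) ⊕ std (select s₂ R)                               ∎
  where
  open ≡-Reasoning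
  k = length B
  s₁ = take k s
  s₂ = drop k s

indecomposable-patterns-shuffleOrShorter : ∀ {B} s {bX bX′} → Indecomposable B → length s ≡ length B →
  BlockWord (std (select s B)) bX → BlockWord (std (select (map not s) B)) bX′ → ShuffleOrShorter bX bX′ [ B ]
indecomposable-patterns-shuffleOrShorter {B} s {[]} {bX′} B-ind |s|≡ (_ , X≡[]) X′-bw =
  inj₂ (subst (λ b → Interleaving [] b [ B ]) (blockWord-unique _ _ (blockWord-single B-ind) B-bw) (consʳ []))
  where
  B-bw : BlockWord B bX′
  B-bw = subst (λ x → BlockWord x bX′)
               (trans (cong std (select-≡[]⇒complement s B |s|≡ (std-[]⁻ X≡[]))) (std-isPerm (proj₁ B-ind))) X′-bw
indecomposable-patterns-shuffleOrShorter {B} s {bX@(_ ∷ _)} {[]} B-ind |s|≡ X-bw (_ , X′≡[]) =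
  inj₂ (subst (λ b → Interleaving b [] [ B ]) (blockWord-unique _ _ (blockWord-single B-ind) B-bw) (consˡ []))
  where
  B-bw : BlockWord B bX
  B-bw = subst (λ x → BlockWord x bX)
               (trans (cong std (complement-≡[]⇒select s B |s|≡ (std-[]⁻ X′≡[]))) (std-isPerm (proj₁ B-ind))) X-bw
indecomposable-patterns-shuffleOrShorter _ {_ ∷ bX} {_ ∷ bX′} _ _ _ _ =
  inj₁ (s≤s (subst (1 ≤_) (sym (+-suc (length bX) (length bX′))) (s≤s z≤n)))

pattern-⊕-blockWord⁻ : ∀ s {B} R {b} → All (_< length B) B → BlockWord (std (select s (B ⊕ R))) b →
  ∃₂ λ bX bY → BlockWord (std (select (take (length B) s) B)) bX ×
               BlockWord (std (select (drop (length B) s) R)) bY × b ≡ bX ++ bY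
pattern-⊕-blockWord⁻ s {B} R {b} B<|B| bw =
  ⊕-blockWord⁻ {v = std (select (drop (length B) s) R)} (std-< (select (take (length B) s) B))
    (subst (λ x → BlockWord x b) (std-select-⊕ s R B<|B|) bw)

patterns-shuffleOrShorter : ∀ bσ s {σ bα bβ} → BlockWord σ bσ → length s ≡ length σ →
  BlockWord (std (select s σ)) bα → BlockWord (std (select (map not s) σ)) bβ → ShuffleOrShorter bα bβ bσ
patterns-shuffleOrShorter [] s (_ , refl) _ α-bw β-bw =
  subst₂ (λ a b → ShuffleOrShorter a b [])
         (sym (blockWord-[]⁻ (subst (λ x → BlockWord (std x) _) (select-[] s) α-bw)))
         (sym (blockWord-[]⁻ (subst (λ x → BlockWord (std x) _) (select-[] (map not s)) β-bw)))
         (inj₂ [])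
patterns-shuffleOrShorter (B ∷ bs) s ((B-ind ∷ bs-ind) , refl) |s|≡ α-bw β-bw =
  let bX , bY , X-bw , Y-bw , bα≡ = pattern-⊕-blockWord⁻ s (⊕-all bs) B<|B| α-bw
      bX′ , bY′ , X′-bw₀ , Y′-bw₀ , bβ≡ = pattern-⊕-blockWord⁻ (map not s) (⊕-all bs) B<|B| β-bw
      X′-bw = subst (λ s′ → BlockWord (std (select s′ B)) bX′) (take-map k s) X′-bw₀
      Y′-bw = subst (λ s′ → BlockWord (std (select s′ (⊕-all bs))) bY′) (drop-map k s) Y′-bw₀
  in subst₂ (λ a b → ShuffleOrShorter a b (B ∷ bs)) (sym bα≡) (sym bβ≡)
       (shuffleOrShorter-++ (indecomposable-patterns-shuffleOrShorter (take k s) B-ind |s₁| X-bw X′-bw)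
                            (patterns-shuffleOrShorter bs (drop k s) (bs-ind , refl) |s₂| Y-bw Y′-bw))
  where
  k = length B
  B<|B| : All (_< k) B
  B<|B| = isPerm-< (proj₁ B-ind)
  |s|≡′ : length s ≡ k + length (⊕-all bs)
  |s|≡′ = trans |s|≡ (⊕-length B (⊕-all bs))
  |s₁| : length (take k s) ≡ k
  |s₁| = trans (length-take k s) (m≤n⇒m⊓n≡m (subst (k ≤_) (sym |s|≡′) (m≤m+n k _)))
  |s₂| : length (drop k s) ≡ length (⊕-all bs)
  |s₂| = trans (length-drop k s) (trans (cong (_∸ k) |s|≡′) (m+n∸m≡n k _))

-- Constituents of flag products

NonzeroTerm : List ℕ → Comb → Set
NonzeroTerm σ c = ∃[ a ] (a , σ) ∈ c × a ≢ 0ℚ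

constituent⇒nonzeroTerm : ∀ σ c → Constituent σ c → NonzeroTerm σ c
constituent⇒nonzeroTerm σ [] coeff≢0 = contradiction refl coeff≢0
constituent⇒nonzeroTerm σ ((a , τ) ∷ c) coeff≢0 with ≡-dec ℕ._≟_ σ τ
... | no _ = let b , bσ∈c , b≢0 = constituent⇒nonzeroTerm σ c coeff≢0 in b , there bσ∈c , b≢0
... | yes refl with a ≟ℚ 0ℚ
...   | no a≢0 = a , here refl , a≢0
...   | yes refl =
  let b , bσ∈c , b≢0 = constituent⇒nonzeroTerm σ c (coeff≢0 ∘ trans (ℚ.+-identityˡ (coeff σ c))) in b , there bσ∈c , b≢0

nonzeroTerm-single : ∀ {σ a τ} → NonzeroTerm σ [ (a , τ) ] → σ ≡ τ
nonzeroTerm-single (_ , here refl , _) = refl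

SplitsInto : List ℕ → List ℕ → List ℕ → Set
SplitsInto σ τ ρ = ∃[ s ] length s ≡ length σ × std (select s σ) ≡ τ × std (select (map not s) σ) ≡ ρ

insertions-↭ : ∀ x l {w} → w ∈ insertions x l → w ↭ x ∷ l
insertions-↭ x [] (here refl) = ↭-refl
insertions-↭ x (y ∷ l) (here refl) = ↭-refl
insertions-↭ x (y ∷ l) (there w∈) with ∈-map⁻ (y ∷_) w∈
... | w′ , w′∈ , refl = ↭-trans (prep y (insertions-↭ x l w′∈)) (swap y x ↭-refl)

∈-perms⇒↭ : ∀ n {σ} → σ ∈ perms n → σ ↭ upTo n
∈-perms⇒↭ zero (here refl) = ↭-refl
∈-perms⇒↭ (suc n) {σ} σ∈ with find (∈-concatMap⁻ (insertions n) {xs = perms n} σ∈)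
... | w , w∈ , σ∈ins = begin
  σ             ↭⟨ insertions-↭ n w σ∈ins ⟩
  n ∷ w         ↭⟨ prep n (∈-perms⇒↭ n w∈) ⟩
  n ∷ upTo n    ↭⟨ ∷↭∷ʳ n (upTo n) ⟩
  upTo n ∷ʳ n   ≡⟨ upTo-∷ʳ n ⟩
  upTo (suc n)  ∎
  where open PermutationReasoning

∈-perms⇒isPerm : ∀ n {σ} → σ ∈ perms n → IsPerm σ
∈-perms⇒isPerm n σ∈ = subst (λ m → _ ↭ upTo m) (sym (trans (↭-length σ↭) (length-upTo n))) σ↭
  where σ↭ = ∈-perms⇒↭ n σ∈

∈-subsets⇒length : ∀ N k {s} → s ∈ subsets N k → length s ≡ N
∈-subsets⇒length zero zero (here refl) = refl
∈-subsets⇒length (suc N) zero s∈ with ∈-map⁻ (false ∷_) s∈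
... | s′ , s′∈ , refl = cong suc (∈-subsets⇒length N zero s′∈)
∈-subsets⇒length (suc N) (suc k) s∈ with ∈-++⁻ (map (true ∷_) (subsets N k)) s∈
... | inj₁ s∈₁ with ∈-map⁻ (true ∷_) s∈₁
...   | s′ , s′∈ , refl = cong suc (∈-subsets⇒length N k s′∈)
∈-subsets⇒length (suc N) (suc k) s∈ | inj₂ s∈₂ with ∈-map⁻ (false ∷_) s∈₂
...   | s′ , s′∈ , refl = cong suc (∈-subsets⇒length N (suc k) s′∈)

∈-concatMap⁻′ : ∀ {A B : Set} (f : A → List B) {xs y} → y ∈ concatMap f xs → ∃[ x ] x ∈ xs × y ∈ f x
∈-concatMap⁻′ f m = find (∈-concatMap⁻ f m)

numerator≢0 : ∀ n d .{{_ : NonZero d}} → (ℤ+ n) / d ≢ 0ℚ → n ≢ 0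
numerator≢0 n d q≢0 refl = q≢0 (ℚ.0/n≡0 d)

*≢0⇒ˡ≢0 : ∀ a b → a * b ≢ 0ℚ → a ≢ 0ℚ
*≢0⇒ˡ≢0 a b ab≢0 refl = ab≢0 (ℚ.*-zeroˡ b)

*≢0⇒ʳ≢0 : ∀ a b → a * b ≢ 0ℚ → b ≢ 0ℚ
*≢0⇒ʳ≢0 a b ab≢0 refl = ab≢0 (ℚ.*-zeroʳ a)

length≢0⇒∃∈ : ∀ {A : Set} (l : List A) → length l ≢ 0 → ∃[ x ] x ∈ l
length≢0⇒∃∈ [] |l|≢0 = contradiction refl |l|≢0
length≢0⇒∃∈ (x ∷ _) _ = x , here refl

prodPerm-nonzeroTerm : ∀ {σ} τ ρ → NonzeroTerm σ (prodPerm τ ρ) → IsPerm σ × SplitsInto σ τ ρ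
prodPerm-nonzeroTerm τ ρ (r , rσ∈ , r≢0) =
  let σ , σ∈ , rσ≡ = ∈-map⁻ _ rσ∈
      s , s∈ = length≢0⇒∃∈ _ (numerator≢0 (countSplits τ ρ σ) _ {{>-nonZero (C-pos (length ρ) (length τ))}}
                                (λ q≡0 → r≢0 (trans (cong proj₁ rσ≡) q≡0)))
      s∈subsets , τ≡ , ρ≡ = ∈-filter⁻ _ {xs = subsets (length σ) (length τ)} s∈
  in subst (λ w → IsPerm w × SplitsInto w τ ρ) (sym (cong proj₂ rσ≡))
           (∈-perms⇒isPerm (length τ + length ρ) σ∈ , s , ∈-subsets⇒length _ _ s∈subsets , τ≡ , ρ≡)

prodComb-nonzeroTerm : ∀ {σ} c d → NonzeroTerm σ (prodComb c d) →
  ∃₂ λ τ ρ → NonzeroTerm τ c × NonzeroTerm ρ d × IsPerm σ × SplitsInto σ τ ρ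
prodComb-nonzeroTerm c d (r , rσ∈ , r≢0) =
  let (a , τ) , aτ∈c , rσ∈′ = ∈-concatMap⁻′ _ {xs = c} rσ∈
      (b , ρ) , bρ∈d , rσ∈″ = ∈-concatMap⁻′ _ {xs = d} rσ∈′
      (q , _) , qσ∈ , rσ≡ = ∈-map⁻ _ rσ∈″
      abq≢0 = λ abq≡0 → r≢0 (trans (cong proj₁ rσ≡) abq≡0)
      ab≢0 = *≢0⇒ˡ≢0 (a * b) q abq≢0
  in τ , ρ , (a , aτ∈c , *≢0⇒ˡ≢0 a b ab≢0) , (b , bρ∈d , *≢0⇒ʳ≢0 a b ab≢0) ,
     subst (λ w → IsPerm w × SplitsInto w τ ρ) (sym (cong proj₂ rσ≡))
           (prodPerm-nonzeroTerm τ ρ (q , qσ∈ , *≢0⇒ʳ≢0 (a * b) q abq≢0))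

-- The invariant along the flag product

<Σ-trans : ∀ {τ τ′ τ″} → τ <Σ τ′ → τ′ <Σ τ″ → τ <Σ τ″
<Σ-trans (inj₁ |τ|<) (inj₁ |τ′|<) = inj₁ (<-trans |τ|< |τ′|<)
<Σ-trans (inj₁ |τ|<) (inj₂ (|τ′|≡ , _)) = inj₁ (subst (_ <_) |τ′|≡ |τ|<)
<Σ-trans (inj₂ (|τ|≡ , _)) (inj₁ |τ′|<) = inj₁ (subst (_< _) (sym |τ|≡) |τ′|<)
<Σ-trans (inj₂ (|τ|≡ , τ<)) (inj₂ (|τ′|≡ , τ′<)) =
  inj₂ (trans |τ|≡ |τ′|≡ , LexStrict.<-transitive isEquivalence (resp₂ _<_) <-trans τ< τ′<)

-- Here _≤L_, _<L_ and IsLyndon are, definitionally, Defs' _≤W_, _<W_ and Lyndon.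
open Shuffles _<Σ_ <Σ-trans
  using (≤L-trans; _≤Suffixes_; ≤Suffixes-++; lyndon⇒≤Suffixes; _≤shortlex_; ≤shortlex-refl; ≤shortlex∧≢⇒<shortlex; shuffleOrShorter-≤shortlex)

ConstituentsBelow : List (List ℕ) → Comb → Set
ConstituentsBelow x c = ∀ σ → NonzeroTerm σ c → ∃[ bσ ] BlockWord σ bσ × bσ ≤shortlex x

prodComb-constituentsBelow : ∀ {x ρ bρ} c → BlockWord ρ bρ → bρ ≤Suffixes x → ConstituentsBelow x c →
                             ConstituentsBelow (x ++ bρ) (prodComb c [ (1ℚ , ρ) ])
prodComb-constituentsBelow {x} c ρ-bw bρ≤x c-below σ σ∈ =
  let τ , ρ , τ∈ , ρ∈ , σ↭ , s , |s|≡ , τ≡ , ρ≡ = prodComb-nonzeroTerm c _ σ∈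
      bτ , τ-bw , bτ≤x = c-below τ τ∈
      bσ , σ-bw = blockWord-exists σ↭
      α-bw = subst (λ α → BlockWord α bτ) (sym τ≡) τ-bw
      β-bw = subst (λ β → BlockWord β _) (sym (trans ρ≡ (nonzeroTerm-single ρ∈))) ρ-bw
  in bσ , σ-bw , shuffleOrShorter-≤shortlex x bρ≤x bτ≤x (patterns-shuffleOrShorter bσ s σ-bw |s|≡ α-bw β-bw)

foldl-constituentsBelow : ∀ {x c} qs bqs → Pointwise BlockWord qs bqs → All Lyndon bqs →
  AllPairs (λ b b′ → b′ ≤W b) bqs → All (_≤Suffixes x) bqs → ConstituentsBelow x c →
  ConstituentsBelow (x ++ concat bqs) (foldl (λ acc q → prodComb acc [ (1ℚ , q) ]) c qs)
foldl-constituentsBelow {x} {c} [] [] [] [] [] [] c-below = subst (λ y → ConstituentsBelow y c) (sym (++-identityʳ x)) c-below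
foldl-constituentsBelow {x} {c} (q ∷ qs) (bq ∷ bqs) (q-bw ∷ qs-bw) (bq-lyn ∷ bqs-lyn) (bqs≤bq ∷ bqs-pairs) (bq≤x ∷ bqs≤x) c-below =
  subst (λ y → ConstituentsBelow y _) (++-assoc x bq (concat bqs))
    (foldl-constituentsBelow qs bqs qs-bw bqs-lyn bqs-pairs
      (All.zipWith (λ (b≤x , b≤bq) → ≤Suffixes-++ x bq b≤x (lyndon⇒≤Suffixes bq-lyn b≤bq)) (bqs≤x , bqs≤bq))
      (prodComb-constituentsBelow c q-bw bq≤x c-below))

flagProd-constituentsBelow : ∀ {ps bss} → Pointwise BlockWord ps bss → All Lyndon bss →
  Linked (λ b b′ → b′ ≤W b) bss → ConstituentsBelow (concat bss) (flagProd ps)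
flagProd-constituentsBelow [] [] _ σ σ∈ with refl ← nonzeroTerm-single σ∈ = [] , ([] , refl) , ≤shortlex-refl
flagProd-constituentsBelow {p ∷ qs} {bp ∷ bqs} (p-bw ∷ qs-bw) (bp-lyn ∷ bqs-lyn) decreasing
  with bqs≤bp ∷ bqs-pairs ← Linked⇒AllPairs (λ b′≤b b″≤b′ → ≤L-trans b″≤b′ b′≤b) decreasing =
  foldl-constituentsBelow qs bqs qs-bw bqs-lyn bqs-pairs (All.map (lyndon⇒≤Suffixes bp-lyn) bqs≤bp) p-below
  where
  p-below : ConstituentsBelow bp [ (1ℚ , p) ]
  p-below σ σ∈ with refl ← nonzeroTerm-single σ∈ = bp , p-bw , ≤shortlex-refl

lemma2p4 : (π : List ℕ) (ps : List (List ℕ)) (bss : List (List (List ℕ))) →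
    IsPerm π →
    All IsPerm ps →
    Pointwise BlockWord ps bss →
    All Lyndon bss →
    Linked (λ b b′ → b′ ≤W b) bss →
    π ≡ ⊕-all ps →
    (σ : List ℕ) → Constituent σ (flagProd ps) → σ ≢ π →
    (bσ bπ : List (List ℕ)) → BlockWord σ bσ → BlockWord π bπ →
    length bσ < length bπ ⊎ (length bσ ≡ length bπ × bσ <W bπ)
-- The permutation hypotheses on π and ps are implied by the block-word hypotheses.
lemma2p4 π ps bss _ _ ps-bw bss-lyn bss-decreasing π≡ σ σ-constituent σ≢π bσ bπ σ-bw π-bw
  with flagProd-constituentsBelow ps-bw bss-lyn bss-decreasing σ (constituent⇒nonzeroTerm σ _ σ-constituent)
... | bσ′ , σ-bw′ , bσ′≤ = ≤shortlex∧≢⇒<shortlex (subst₂ _≤shortlex_ (sym bσ≡bσ′) (sym bπ≡) bσ′≤) bσ≢bπ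
  where
  bπ≡ : bπ ≡ concat bss
  bπ≡ = blockWord-unique _ _ π-bw (subst (λ w → BlockWord w (concat bss)) (sym π≡) (blockWord-⊕-all ps-bw))
  bσ≡bσ′ : bσ ≡ bσ′
  bσ≡bσ′ = blockWord-unique _ _ σ-bw σ-bw′
  bσ≢bπ : bσ ≢ bπ
  bσ≢bπ refl = σ≢π (trans (proj₂ σ-bw) (sym (proj₂ π-bw)))
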